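{- Let $G$ be a graph containing a vertex $r$ that is contained in at least one, but not all, minimum vertex covers of $G$, and such that $N[r]\subsetneq V(G)$. Let $Y$ be a minimal blocking set of $G$ with $r\notin Y$. Then: (i) $Y$ is a blocking set of $G-r$ and $Y\setminus N[r]$ is a blocking set of $G-N[r]$; (ii) for every minimal blocking set $Y'$ of $G-r$ and every minimal blocking set $\tilde Y$ of $G-N[r]$, the set $Y'\cup\tilde Y$ is a blocking set of $G$; (iii) for every $y\in Y$, the set $Y\setminus\{y\}$ is not a blocking set of $G-r$ or the set $Y\setminus(\{y\}\cup N[r])$ is not a blocking set of $G-N[r]$.
   Context: All graphs are finite, simple and undirected. $N(r)$ is the open and $N[r]=N(r)\cup\{r\}$ the closed neighborhood of $r$. A minimum vertex cover is a vertex cover of minimum size. A set $Y\subseteq V(G)$ is a blocking set of $G$ if no minimum vertex cover of $G$ contains $Y$; minimal if no proper subset of $Y$ is a blocking set. -}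

module Defs where

open import Data.Bool using (Bool; true; false; _∨_)
open import Data.Nat using (ℕ; _≤_)
open import Data.Fin using (Fin; _≟_)
open import Data.Fin.Subset using (Subset; _∈_; _∉_; _⊆_; _⊂_; ⊤; ∁; _─_; _-_; ∣_∣)
open import Data.Vec using (tabulate)
open import Data.Product using (_×_; ∃)
open import Data.Sum using (_⊎_)
open import Relation.Nullary using (¬_; does)
open import Relation.Binary.PropositionalEquality using (_≡_)

record Graph (n : ℕ) : Set where
  field
    adj   : Fin n → Fin n → Bool
    sym   : ∀ u v → adj u v ≡ adj v u
    irrefl : ∀ v → adj v v ≡ false
open Graph public

Adj : ∀ {n} → Graph n → Fin n → Fin n → Set
Adj G u v = adj G u v ≡ true

-- Induced subgraphs G[S] are represented by the pair (G , S), S ⊆ Fin n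
-- being the vertex set.  The whole graph G is (G , ⊤).

closedNbhd : ∀ {n} → Graph n → Fin n → Subset n
closedNbhd G r = tabulate (λ v → adj G r v ∨ does (r ≟ v))

IsVertexCover : ∀ {n} → Graph n → Subset n → Subset n → Set
IsVertexCover G S C =
  C ⊆ S × (∀ u v → u ∈ S → v ∈ S → Adj G u v → u ∈ C ⊎ v ∈ C)

IsMinVertexCover : ∀ {n} → Graph n → Subset n → Subset n → Set
IsMinVertexCover G S C =
  IsVertexCover G S C × (∀ C' → IsVertexCover G S C' → ∣ C ∣ ≤ ∣ C' ∣)

IsBlocking : ∀ {n} → Graph n → Subset n → Subset n → Set
IsBlocking G S Y =
  Y ⊆ S × (∀ C → IsMinVertexCover G S C → ¬ (Y ⊆ C))

IsMinimalBlocking : ∀ {n} → Graph n → Subset n → Subset n → Set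
IsMinimalBlocking G S Y =
  IsBlocking G S Y × (∀ Y' → Y' ⊂ Y → ¬ IsBlocking G S Y')

V-minus : ∀ {n} → Fin n → Subset n
V-minus r = ⊤ - r

V-minusN : ∀ {n} → Graph n → Fin n → Subset n
V-minusN G r = ⊤ ─ closedNbhd G r

module Submission where

-- Write N = N[r].  Deleting a vertex set X from G and adding
-- back a "compensating" set K relates minimum vertex covers of G and G - X:
-- if D ∪ K covers G whenever D covers G - X, and some minimum cover C of G
-- meets X in at least |K| vertices, then C ─ X is a minimum cover of G - X
-- and D ∪ K is a minimum cover of G for every minimum cover D of G - X.
-- We use this twice: for X = K = {r} when r lies in a minimum cover, and
-- for X = N, K = C ∩ N when C is a minimum cover avoiding r (such a C
-- contains N[r] - r).  Every minimum cover of G either contains r or avoids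
-- it, so a set Z blocks G as soon as part of it blocks G - r and part of it
-- blocks G - N[r] ("blocking ascends"); conversely, minimum covers of the
-- smaller graphs extend to G, so blocking sets of G descend.  Part (i) is
-- descent, part (ii) is ascent, and part (iii) is ascent applied to Y - y,
-- contradicting minimality of Y (constructively: we decide whether the
-- second set is blocking, which is possible since everything is finite).

open import Defs
open import Data.Nat using (ℕ)
open import Data.Fin using (Fin)
open import Data.Fin.Subset using (Subset; _∈_; _∉_; _∪_; _─_; _-_; ⊤; ⁅_⁆)
open import Data.Product using (_×_; ∃)
open import Data.Sum using (_⊎_)
open import Relation.Nullary using (¬_)

open import Data.Bool using (true; false; _∨_)
open import Data.Bool.Properties using (∨-identityʳ) renaming (_≟_ to _≟ᵇ_)
open import Data.Nat using (suc; _+_; _≤_; _≤?_; z≤n; s≤s)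
open import Data.Nat.Properties
  using (≤-trans; ≤-reflexive; ≤-refl; +-suc; +-monoʳ-≤; +-mono-≤; +-cancelʳ-≤; module ≤-Reasoning)
open import Data.Fin using (zero; suc; _≟_)
open import Data.Fin.Properties using (all?)
open import Data.Fin.Subset using (_⊆_; _∩_; ∣_∣)
open import Data.Fin.Subset.Properties
open import Data.Vec using (_∷_; []; here; there)
open import Data.Vec.Properties using (lookup∘tabulate; []=⇒lookup; lookup⇒[]=)
open import Data.Product using (_,_; proj₁; proj₂)
open import Data.Sum using (inj₁; inj₂; swap)
import Data.Sum as Sum
open import Data.Empty using (⊥-elim)
open import Function using (id)
open import Relation.Nullary using (Dec; yes; no; does)
open import Relation.Nullary.Decidable using (dec-true; ¬?; _×-dec_; _⊎-dec_; _→-dec_)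
open import Relation.Binary.PropositionalEquality
  using (_≡_; _≢_; refl; trans; cong; cong₂; subst)
  renaming (sym to ≡-sym)

x∈p─q⁻ : ∀ {n} (p q : Subset n) {x} → x ∈ p ─ q → x ∈ p × x ∉ q
x∈p─q⁻ (s ∷ p) (true ∷ q) {zero} ()
x∈p─q⁻ (s ∷ p) (false ∷ q) {zero} here = here , λ ()
x∈p─q⁻ (s ∷ p) (t ∷ q) {suc x} (there x∈p─q) =
  let x∈p , x∉q = x∈p─q⁻ p q x∈p─q in there x∈p , λ { (there x∈q) → x∉q x∈q }

∣p∪q∣≤∣p∣+∣q∣ : ∀ {n} (p q : Subset n) → ∣ p ∪ q ∣ ≤ ∣ p ∣ + ∣ q ∣
∣p∪q∣≤∣p∣+∣q∣ [] [] = z≤n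
∣p∪q∣≤∣p∣+∣q∣ (true ∷ p) (t ∷ q) =
  s≤s (≤-trans (∣p∪q∣≤∣p∣+∣q∣ p q) (+-monoʳ-≤ ∣ p ∣ (∣p∣≤∣x∷p∣ t q)))
∣p∪q∣≤∣p∣+∣q∣ (false ∷ p) (true ∷ q) =
  ≤-trans (s≤s (∣p∪q∣≤∣p∣+∣q∣ p q)) (≤-reflexive (≡-sym (+-suc ∣ p ∣ ∣ q ∣)))
∣p∪q∣≤∣p∣+∣q∣ (false ∷ p) (false ∷ q) = ∣p∪q∣≤∣p∣+∣q∣ p q

∣p∣≡∣p─q∣+∣p∩q∣ : ∀ {n} (p q : Subset n) → ∣ p ∣ ≡ ∣ p ─ q ∣ + ∣ p ∩ q ∣
∣p∣≡∣p─q∣+∣p∩q∣ [] [] = refl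
∣p∣≡∣p─q∣+∣p∩q∣ (true ∷ p) (true ∷ q) =
  trans (cong suc (∣p∣≡∣p─q∣+∣p∩q∣ p q)) (≡-sym (+-suc ∣ p ─ q ∣ ∣ p ∩ q ∣))
∣p∣≡∣p─q∣+∣p∩q∣ (true ∷ p) (false ∷ q) = cong suc (∣p∣≡∣p─q∣+∣p∩q∣ p q)
∣p∣≡∣p─q∣+∣p∩q∣ (false ∷ p) (true ∷ q) = ∣p∣≡∣p─q∣+∣p∩q∣ p q
∣p∣≡∣p─q∣+∣p∩q∣ (false ∷ p) (false ∷ q) = ∣p∣≡∣p─q∣+∣p∩q∣ p q

-- All notions are decidable, by exhaustive search over the finitely many
-- vertices and subsets.  Part (iii) needs this to choose a disjunct.
module Decidability {n} (G : Graph n) where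

  vertexCover? : ∀ S C → Dec (IsVertexCover G S C)
  vertexCover? S C = (C ⊆? S) ×-dec all? λ u → all? λ v →
    (u ∈? S) →-dec ((v ∈? S) →-dec ((adj G u v ≟ᵇ true) →-dec ((u ∈? C) ⊎-dec (v ∈? C))))

  minVertexCover? : ∀ S C → Dec (IsMinVertexCover G S C)
  minVertexCover? S C
    with vertexCover? S C
       | anySubset? (λ C' → vertexCover? S C' ×-dec ¬? (∣ C ∣ ≤? ∣ C' ∣))
  ... | no ¬cover | _ = no λ minC → ¬cover (proj₁ minC)
  ... | yes _ | yes (C' , coverC' , C≰C') = no λ minC → C≰C' (proj₂ minC C' coverC')
  ... | yes cover | no noSmaller = yes (cover , minimum)
    where
    minimum : ∀ C' → IsVertexCover G S C' → ∣ C ∣ ≤ ∣ C' ∣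
    minimum C' coverC' with ∣ C ∣ ≤? ∣ C' ∣
    ... | yes C≤C' = C≤C'
    ... | no C≰C' = ⊥-elim (noSmaller (C' , coverC' , C≰C'))

  blocking? : ∀ S Z → Dec (IsBlocking G S Z)
  blocking? S Z with Z ⊆? S | anySubset? (λ C → minVertexCover? S C ×-dec (Z ⊆? C))
  ... | no Z⊈S | _ = no λ blocks → Z⊈S (proj₁ blocks)
  ... | yes _ | yes (C , minC , Z⊆C) = no λ blocks → proj₂ blocks C minC Z⊆C
  ... | yes Z⊆S | no noCover = yes (Z⊆S , λ C minC Z⊆C → noCover (C , minC , Z⊆C))

module Deletion {n} (G : Graph n) where

  restrict-cover : ∀ {S C} X → IsVertexCover G S C → IsVertexCover G (S ─ X) (C ─ X)
  restrict-cover {S} {C} X (C⊆S , covers) = C─X⊆S─X , covers-S─X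
    where
    C─X⊆S─X : C ─ X ⊆ S ─ X
    C─X⊆S─X x∈C─X = let x∈C , x∉X = x∈p─q⁻ C X x∈C─X in x∈p∧x∉q⇒x∈p─q (C⊆S x∈C) x∉X

    covers-S─X : ∀ u v → u ∈ S ─ X → v ∈ S ─ X → Adj G u v → u ∈ C ─ X ⊎ v ∈ C ─ X
    covers-S─X u v u∈S─X v∈S─X uv =
      let u∈S , u∉X = x∈p─q⁻ S X u∈S─X
          v∈S , v∉X = x∈p─q⁻ S X v∈S─X
      in Sum.map (λ u∈C → x∈p∧x∉q⇒x∈p─q u∈C u∉X) (λ v∈C → x∈p∧x∉q⇒x∈p─q v∈C v∉X)
                 (covers u v u∈S v∈S uv)

  Compensates : Subset n → Subset n → Subset n → Set
  Compensates S X K = ∀ D → IsVertexCover G (S ─ X) D → IsVertexCover G S (D ∪ K)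

  restrict-min : ∀ {S X K C} → Compensates S X K → IsMinVertexCover G S C
               → ∣ K ∣ ≤ ∣ C ∩ X ∣ → IsMinVertexCover G (S ─ X) (C ─ X)
  restrict-min {X = X} {K} {C} compensates (coverC , minimum) K≤C∩X =
    restrict-cover X coverC , λ D coverD → +-cancelʳ-≤ ∣ C ∩ X ∣ _ _ (begin
      ∣ C ─ X ∣ + ∣ C ∩ X ∣  ≡⟨ ≡-sym (∣p∣≡∣p─q∣+∣p∩q∣ C X) ⟩
      ∣ C ∣                  ≤⟨ minimum _ (compensates D coverD) ⟩
      ∣ D ∪ K ∣              ≤⟨ ∣p∪q∣≤∣p∣+∣q∣ D K ⟩
      ∣ D ∣ + ∣ K ∣          ≤⟨ +-monoʳ-≤ ∣ D ∣ K≤C∩X ⟩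
      ∣ D ∣ + ∣ C ∩ X ∣      ∎)
    where open ≤-Reasoning

  extend-min : ∀ {S X K C} → Compensates S X K → IsMinVertexCover G S C
             → ∣ K ∣ ≤ ∣ C ∩ X ∣
             → ∀ {D} → IsMinVertexCover G (S ─ X) D → IsMinVertexCover G S (D ∪ K)
  extend-min {X = X} {K} {C} compensates (coverC , minimum) K≤C∩X {D} (coverD , minimumD) =
    compensates D coverD , λ E coverE → begin
      ∣ D ∪ K ∣              ≤⟨ ∣p∪q∣≤∣p∣+∣q∣ D K ⟩
      ∣ D ∣ + ∣ K ∣          ≤⟨ +-mono-≤ (minimumD _ (restrict-cover X coverC)) K≤C∩X ⟩
      ∣ C ─ X ∣ + ∣ C ∩ X ∣  ≡⟨ ≡-sym (∣p∣≡∣p─q∣+∣p∩q∣ C X) ⟩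
      ∣ C ∣                  ≤⟨ minimum E coverE ⟩
      ∣ E ∣                  ∎
    where open ≤-Reasoning

  blocking-descends : ∀ {S S' K Y Z} → IsBlocking G S Y → Z ⊆ S' → Y ⊆ Z ∪ K
    → (∀ {D} → IsMinVertexCover G S' D → IsMinVertexCover G S (D ∪ K))
    → IsBlocking G S' Z
  blocking-descends {K = K} {Z = Z} (_ , blocks) Z⊆S' Y⊆Z∪K extend =
    Z⊆S' , λ D minD Z⊆D →
      blocks _ (extend minD) λ y∈Y → x∈p∪q⁺ (Sum.map Z⊆D id (x∈p∪q⁻ Z K (Y⊆Z∪K y∈Y)))

module AroundVertex {n} (G : Graph n) (r : Fin n) where
  open Deletion G

  N : Subset n
  N = closedNbhd G r

  Vr : Subset n
  Vr = V-minus r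

  VN : Subset n
  VN = V-minusN G r

  adj⇒≢ : ∀ {u v} → Adj G u v → u ≢ v
  adj⇒≢ {u} uv refl with () ← trans (≡-sym (irrefl G u)) uv

  adj⇒∈N : ∀ {v} → Adj G r v → v ∈ N
  adj⇒∈N {v} rv = lookup⇒[]= v N (trans (lookup∘tabulate _ v) (cong (_∨ does (r ≟ v)) rv))

  ∈N⇒adj : ∀ {v} → v ∈ N → v ≢ r → Adj G r v
  ∈N⇒adj {v} v∈N v≢r
    with r ≟ v | trans (≡-sym (lookup∘tabulate (λ w → adj G r w ∨ does (r ≟ w)) v)) ([]=⇒lookup v∈N)
  ... | yes r≡v | _ = ⊥-elim (v≢r (≡-sym r≡v))
  ... | no _ | rv∨false = trans (≡-sym (∨-identityʳ _)) rv∨false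

  r∈N : r ∈ N
  r∈N = lookup⇒[]= r N
    (trans (lookup∘tabulate _ r) (cong₂ _∨_ (irrefl G r) (dec-true (r ≟ r) refl)))

  ∈Vr : ∀ {x} → x ≢ r → x ∈ Vr
  ∈Vr = x∈p∧x≢y⇒x∈p-y ∈⊤

  ∈Vr⁻ : ∀ {x} → x ∈ Vr → x ≢ r
  ∈Vr⁻ x∈Vr = x∉⁅y⁆⇒x≢y (proj₂ (x∈p─q⁻ ⊤ ⁅ r ⁆ x∈Vr))

  ∈VN : ∀ {x} → x ∉ N → x ∈ VN
  ∈VN = x∈p∧x∉q⇒x∈p─q ∈⊤

  ∈VN⁻ : ∀ {x} → x ∈ VN → x ∉ N
  ∈VN⁻ x∈VN = proj₂ (x∈p─q⁻ ⊤ N x∈VN)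

  -- Every edge outside G - r meets r, so {r} compensates for deleting r.
  add-r : Compensates ⊤ ⁅ r ⁆ ⁅ r ⁆
  add-r D (_ , coversD) = (λ _ → ∈⊤) , covers
    where
    covers : ∀ u v → u ∈ ⊤ → v ∈ ⊤ → Adj G u v → u ∈ D ∪ ⁅ r ⁆ ⊎ v ∈ D ∪ ⁅ r ⁆
    covers u v _ _ uv with u ≟ r | v ≟ r
    ... | yes refl | _ = inj₁ (q⊆p∪q D _ (x∈⁅x⁆ r))
    ... | no _ | yes refl = inj₂ (q⊆p∪q D _ (x∈⁅x⁆ r))
    ... | no u≢r | no v≢r = Sum.map (p⊆p∪q _) (p⊆p∪q _) (coversD u v (∈Vr u≢r) (∈Vr v≢r) uv)

  nbhd-covered : ∀ {C v} → IsVertexCover G ⊤ C → r ∉ C → v ∈ N → v ≢ r → v ∈ C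
  nbhd-covered (_ , covers) r∉C v∈N v≢r with covers r _ ∈⊤ ∈⊤ (∈N⇒adj v∈N v≢r)
  ... | inj₁ r∈C = ⊥-elim (r∉C r∈C)
  ... | inj₂ v∈C = v∈C

  -- For a cover C avoiding r, C ∩ N[r] compensates for deleting N[r]:
  -- an edge meeting N[r] has an endpoint in N[r] - r, which lies in C.
  add-nbhd : ∀ {C} → IsVertexCover G ⊤ C → r ∉ C → Compensates ⊤ N (C ∩ N)
  add-nbhd {C} coverC r∉C D (_ , coversD) = (λ _ → ∈⊤) , covers
    where
    in-C∩N : ∀ {v} → v ∈ N → v ≢ r → v ∈ D ∪ (C ∩ N)
    in-C∩N v∈N v≢r = q⊆p∪q D _ (x∈p∩q⁺ (nbhd-covered coverC r∉C v∈N v≢r , v∈N))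

    near-r : ∀ u v → Adj G u v → u ∈ N → u ∈ D ∪ (C ∩ N) ⊎ v ∈ D ∪ (C ∩ N)
    near-r u v uv u∈N with u ≟ r
    ... | yes refl = inj₂ (in-C∩N (adj⇒∈N uv) λ v≡r → adj⇒≢ uv (≡-sym v≡r))
    ... | no u≢r = inj₁ (in-C∩N u∈N u≢r)

    covers : ∀ u v → u ∈ ⊤ → v ∈ ⊤ → Adj G u v → u ∈ D ∪ (C ∩ N) ⊎ v ∈ D ∪ (C ∩ N)
    covers u v _ _ uv with u ∈? N | v ∈? N
    ... | yes u∈N | _ = near-r u v uv u∈N
    ... | no _ | yes v∈N = swap (near-r v u (trans (Graph.sym G v u) uv) v∈N)
    ... | no u∉N | no v∉N = Sum.map (p⊆p∪q _) (p⊆p∪q _) (coversD u v (∈VN u∉N) (∈VN v∉N) uv)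

  ∣⁅r⁆∣≤∣C∩⁅r⁆∣ : ∀ {C} → r ∈ C → ∣ ⁅ r ⁆ ∣ ≤ ∣ C ∩ ⁅ r ⁆ ∣
  ∣⁅r⁆∣≤∣C∩⁅r⁆∣ {C} r∈C = p⊆q⇒∣p∣≤∣q∣ λ x∈⁅r⁆ →
    x∈p∩q⁺ (subst (_∈ C) (≡-sym (x∈⁅y⁆⇒x≡y r x∈⁅r⁆)) r∈C , x∈⁅r⁆)

  minus-r-min : ∀ {C} → IsMinVertexCover G ⊤ C → r ∈ C → IsMinVertexCover G Vr (C - r)
  minus-r-min minC r∈C = restrict-min add-r minC (∣⁅r⁆∣≤∣C∩⁅r⁆∣ r∈C)

  plus-r-min : ∀ {C D} → IsMinVertexCover G ⊤ C → r ∈ C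
             → IsMinVertexCover G Vr D → IsMinVertexCover G ⊤ (D ∪ ⁅ r ⁆)
  plus-r-min minC r∈C = extend-min add-r minC (∣⁅r⁆∣≤∣C∩⁅r⁆∣ r∈C)

  minus-N-min : ∀ {C} → IsMinVertexCover G ⊤ C → r ∉ C → IsMinVertexCover G VN (C ─ N)
  minus-N-min minC r∉C = restrict-min (add-nbhd (proj₁ minC) r∉C) minC ≤-refl

  plus-N-min : ∀ {C D} → IsMinVertexCover G ⊤ C → r ∉ C
             → IsMinVertexCover G VN D → IsMinVertexCover G ⊤ (D ∪ (C ∩ N))
  plus-N-min minC r∉C = extend-min (add-nbhd (proj₁ minC) r∉C) minC ≤-refl

  -- Blocking ascends: Z blocks G if some Z₁ ⊆ Z blocks G - r and some
  -- Z₂ ⊆ Z blocks G - N[r], since every minimum cover contains or avoids r.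
  blocking-ascends : ∀ {Z Z₁ Z₂} → Z₁ ⊆ Z → IsBlocking G Vr Z₁
                   → Z₂ ⊆ Z → IsBlocking G VN Z₂ → IsBlocking G ⊤ Z
  blocking-ascends {Z} Z₁⊆Z (Z₁⊆Vr , blocks₁) Z₂⊆Z (Z₂⊆VN , blocks₂) =
    (λ _ → ∈⊤) , no-cover
    where
    no-cover : ∀ C → IsMinVertexCover G ⊤ C → ¬ Z ⊆ C
    no-cover C minC Z⊆C with r ∈? C
    ... | yes r∈C = blocks₁ _ (minus-r-min minC r∈C) λ z∈Z₁ →
            x∈p∧x≢y⇒x∈p-y (Z⊆C (Z₁⊆Z z∈Z₁)) (∈Vr⁻ (Z₁⊆Vr z∈Z₁))
    ... | no r∉C = blocks₂ _ (minus-N-min minC r∉C) λ z∈Z₂ →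
            x∈p∧x∉q⇒x∈p─q (Z⊆C (Z₂⊆Z z∈Z₂)) (∈VN⁻ (Z₂⊆VN z∈Z₂))

  blocking-minus-r : ∀ {C Y} → IsMinVertexCover G ⊤ C → r ∈ C
                   → IsBlocking G ⊤ Y → r ∉ Y → IsBlocking G Vr Y
  blocking-minus-r minC r∈C blocksY r∉Y =
    blocking-descends blocksY (λ y∈Y → ∈Vr λ { refl → r∉Y y∈Y }) (p⊆p∪q _) (plus-r-min minC r∈C)

  blocking-minus-N : ∀ {C Y} → IsMinVertexCover G ⊤ C → r ∉ C
                   → IsBlocking G ⊤ Y → r ∉ Y → IsBlocking G VN (Y ─ N)
  blocking-minus-N {C} {Y} minC r∉C blocksY r∉Y =
    blocking-descends blocksY (λ y∈Y─N → ∈VN (proj₂ (x∈p─q⁻ Y N y∈Y─N))) Y⊆outside∪inside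
      (plus-N-min minC r∉C)
    where
    Y⊆outside∪inside : Y ⊆ (Y ─ N) ∪ (C ∩ N)
    Y⊆outside∪inside {y} y∈Y with y ∈? N
    ... | yes y∈N = q⊆p∪q _ _
          (x∈p∩q⁺ (nbhd-covered (proj₁ minC) r∉C y∈N (λ { refl → r∉Y y∈Y }) , y∈N))
    ... | no y∉N = p⊆p∪q _ (x∈p∧x∉q⇒x∈p─q y∈Y y∉N)

  union-blocking : ∀ {Y' Ỹ} → IsBlocking G Vr Y' → IsBlocking G VN Ỹ → IsBlocking G ⊤ (Y' ∪ Ỹ)
  union-blocking blocksY' blocksỸ = blocking-ascends (p⊆p∪q _) blocksY' (q⊆p∪q _ _) blocksỸ

  -- Part (iii): in a minimal blocking set Y no vertex y is redundant for
  -- both smaller graphs, else Y - y would block G by ascent.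
  no-redundant-vertex : ∀ {Y y} → IsMinimalBlocking G ⊤ Y → y ∈ Y
    → ¬ IsBlocking G Vr (Y - y) ⊎ ¬ IsBlocking G VN (Y ─ (⁅ y ⁆ ∪ N))
  no-redundant-vertex {Y} {y} (_ , minimal) y∈Y with Decidability.blocking? G VN (Y ─ (⁅ y ⁆ ∪ N))
  ... | no ¬blocksN = inj₂ ¬blocksN
  ... | yes blocksN = inj₁ λ blocks-r →
          minimal (Y - y) (x∈p⇒p-x⊂p y∈Y) (blocking-ascends id blocks-r ⊆Y-y blocksN)
    where
    ⊆Y-y : Y ─ (⁅ y ⁆ ∪ N) ⊆ Y - y
    ⊆Y-y = subst (_⊆ Y - y) (p─q─r≡p─q∪r Y ⁅ y ⁆ N) (p─q⊆p (Y - y) N)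

lemma20 : ∀ {n} (G : Graph n) (r : Fin n)
    → (∃ λ C → IsMinVertexCover G ⊤ C × r ∈ C)
    → (∃ λ C → IsMinVertexCover G ⊤ C × r ∉ C)
    → (∃ λ v → v ∉ closedNbhd G r)
    → (Y : Subset n) → IsMinimalBlocking G ⊤ Y → r ∉ Y
    → (IsBlocking G (V-minus r) Y
    × IsBlocking G (V-minusN G r) (Y ─ closedNbhd G r))
    × (∀ Y' Ỹ → IsMinimalBlocking G (V-minus r) Y'
    → IsMinimalBlocking G (V-minusN G r) Ỹ
    → IsBlocking G ⊤ (Y' ∪ Ỹ))
    × (∀ y → y ∈ Y
    → ¬ IsBlocking G (V-minus r) (Y - y)
    ⊎ ¬ IsBlocking G (V-minusN G r) (Y ─ (⁅ y ⁆ ∪ closedNbhd G r)))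
lemma20 G r (C₀ , minC₀ , r∈C₀) (C₁ , minC₁ , r∉C₁) _ Y minimalY r∉Y =
  ( ( blocking-minus-r minC₀ r∈C₀ (proj₁ minimalY) r∉Y
    , blocking-minus-N minC₁ r∉C₁ (proj₁ minimalY) r∉Y )
  , (λ Y' Ỹ minimalY' minimalỸ → union-blocking (proj₁ minimalY') (proj₁ minimalỸ))
  , (λ y y∈Y → no-redundant-vertex minimalY y∈Y) )
  where open AroundVertex G r
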